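{- Let $G$ be a $3$-connected cubic graph, let $H$ be a connected proper subgraph of $G$, and let $x,y\in V(H)$. Then there exists a path $P\subseteq H$ from $x$ to $y$ such that every component of $H\setminus E(P)$ contains a vertex $v$ with $\deg_H(v)\le 2$.
   Context: $H\setminus E(P)$ denotes the graph obtained from $H$ by deleting the edges of $P$ (keeping all vertices); $\deg_H$ is degree in $H$. -}

module Defs where

open import Data.Nat using (ℕ; _≤_; _≥_)
open import Data.Bool using (Bool; true; false)
open import Data.Fin using (Fin)
open import Data.Fin.Subset using (Subset; _∈_; _∉_; ∣_∣)
open import Data.Vec using (tabulate)
open import Data.List using (List; []; _∷_)
open import Data.List.Relation.Unary.Unique.Propositional using (Unique)
open import Data.Product using (Σ; ∃; _×_; _,_)
open import Data.Sum using (_⊎_)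
open import Relation.Binary.PropositionalEquality using (_≡_)
open import Relation.Nullary using (¬_)

record Graph (n : ℕ) : Set where
  field
    adj    : Fin n → Fin n → Bool
    sym    : ∀ u v → adj u v ≡ adj v u
    irrefl : ∀ v → adj v v ≡ false
open Graph public

Adj : ∀ {n} → Graph n → Fin n → Fin n → Set
Adj G u v = adj G u v ≡ true

deg : ∀ {n} → Graph n → Fin n → ℕ
deg G v = ∣ tabulate (adj G v) ∣

data Walk {n : ℕ} (E : Fin n → Fin n → Set) : Fin n → Fin n → Set where
  nil  : ∀ {u} → Walk E u u
  cons : ∀ {u v w} → E u v → Walk E v w → Walk E u w

verts : ∀ {n} {E : Fin n → Fin n → Set} {u v} → Walk E u v → List (Fin n)
verts {u = u} nil        = u ∷ []
verts {u = u} (cons _ w) = u ∷ verts w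

EdgeOf : ∀ {n} {E : Fin n → Fin n → Set} {u v} → Walk E u v → Fin n → Fin n → Set
EdgeOf nil a b = Data.Empty.⊥
  where import Data.Empty
EdgeOf {u = u} (cons {v = v} _ w) a b =
  ((a ≡ u × b ≡ v) ⊎ (a ≡ v × b ≡ u)) ⊎ EdgeOf w a b

Reach : ∀ {n} → (Fin n → Fin n → Set) → Fin n → Fin n → Set
Reach E u v = Walk E u v

AdjAvoid : ∀ {n} → Graph n → Subset n → Fin n → Fin n → Set
AdjAvoid G X u v = Adj G u v × u ∉ X × v ∉ X

ThreeConnected : ∀ {n} → Graph n → Set
ThreeConnected {n} G =
  n ≥ 4 × (∀ (X : Subset n) → ∣ X ∣ ≤ 2 →
             ∀ u v → u ∉ X → v ∉ X → Reach (AdjAvoid G X) u v)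

Cubic : ∀ {n} → Graph n → Set
Cubic G = ∀ v → deg G v ≡ 3

IsSubgraph : ∀ {n} → Graph n → Subset n → Graph n → Set
IsSubgraph G VH H = ∀ u v → Adj H u v → Adj G u v × u ∈ VH × v ∈ VH

Proper : ∀ {n} → Graph n → Subset n → Graph n → Set
Proper G VH H = (∃ λ v → v ∉ VH) ⊎ (∃ λ u → ∃ λ v → Adj G u v × ¬ Adj H u v)

ConnectedSub : ∀ {n} → Subset n → Graph n → Set
ConnectedSub VH H = ∀ u v → u ∈ VH → v ∈ VH → Reach (Adj H) u v

IsPath : ∀ {n} {H : Graph n} {x y} → Walk (Adj H) x y → Set
IsPath P = Unique (verts P)

AdjMinusPath : ∀ {n} (H : Graph n) {x y} → Walk (Adj H) x y → Fin n → Fin n → Set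
AdjMinusPath H P u v = Adj H u v × ¬ EdgeOf P u v

-- Strengthen the statement: each end of the path may carry a flag, and a vertex z is low if
-- deg_H z, plus one for each flagged end equal to z, is at most 2. Claim: if H has a low vertex u,
-- some x–y path P leaves a low vertex in every component of H ∖ E(P). Induct on the number of
-- edges. If u is isolated, H is the single vertex u = x = y. Otherwise take an edge uv. If uv lies
-- on a cycle, solve H − uv, where u is still low; a component whose low vertex is v reaches u
-- along uv, which P avoids. If uv is a bridge, either x and y lie on one side, which is solved on
-- its own while the other side, untouched by P, reaches the low end u (through uv if necessary);
-- or they are separated, and each side is solved with the bridge end as an extra, flagged end of
-- its path, the two paths being joined through uv.
--
-- A side of a bridge has a low vertex because it misses a vertex o of G: were no vertex low, every
-- vertex other than x, y would keep all three of its G-edges, so a walk to o in G − {x, y}, given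
-- by 3-connectivity, could not leave the side; and if there is no such vertex, x is low. For the
-- original H, properness yields a missing vertex or a vertex with a missing edge, which is low.
module Submission where

open import Defs renaming (sym to adj-sym)
open import Data.Nat using (ℕ; zero; suc; _+_; _≤_; _<_; z≤n; s≤s; _≤?_)
open import Data.Nat.Properties
open import Data.Nat.Tactic.RingSolver using (solve-∀)
open import Data.Bool using (Bool; true; false; _∧_)
open import Data.Bool.Properties using () renaming (_≟_ to _≟ᵇ_)
open import Data.Fin using (Fin; zero; suc)
open import Data.Fin.Properties using (any?) renaming (_≟_ to _≟ᶠ_)
open import Data.Fin.Subset using (Subset; _∈_; _∉_; ∣_∣; _∪_; _-_; ⊤; ⁅_⁆) renaming (⊥ to ∅)
open import Data.Fin.Subset.Properties
open import Data.Vec using ([]; _∷_; tabulate; sum)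
open import Data.Vec.Properties using ([]=⇒lookup; lookup⇒[]=; lookup∘tabulate)
open import Data.List using ([]; _∷_; _++_)
open import Data.List.Relation.Unary.All as All using (All; []; _∷_)
open import Data.List.Relation.Unary.AllPairs using ([]; _∷_)
open import Data.List.Relation.Unary.Unique.Propositional using (Unique)
import Data.List.Relation.Unary.Unique.Propositional.Properties as Unique
open import Data.Product using (Σ; ∃; _×_; _,_; proj₁; proj₂)
import Data.Product
open import Data.Sum using (_⊎_; inj₁; inj₂)
import Data.Sum
open import Data.Empty using (⊥)
open import Relation.Binary.PropositionalEquality using (_≡_; _≢_; refl; sym; trans; cong; cong₂; subst)
open import Relation.Nullary using (¬_; contradiction; Dec; yes; no; does; ¬?)
open import Relation.Nullary.Decidable using (map′; _×-dec_; _⊎-dec_; dec-true; does-⇔; decidable-stable)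
open import Function.Bundles using (mk⇔)
open import Function.Base using (_$_)
open import Induction.WellFounded using (Acc; acc)
open import Data.Nat.Induction using (<-wellFounded)

∣p∪q∣≤∣p∣+∣q∣ : ∀ {n} (p q : Subset n) → ∣ p ∪ q ∣ ≤ ∣ p ∣ + ∣ q ∣
∣p∪q∣≤∣p∣+∣q∣ []          []          = z≤n
∣p∪q∣≤∣p∣+∣q∣ (true ∷ p)  (true ∷ q)  =
  s≤s (≤-trans (∣p∪q∣≤∣p∣+∣q∣ p q) (≤-trans (n≤1+n _) (≤-reflexive (sym (+-suc _ _)))))
∣p∪q∣≤∣p∣+∣q∣ (true ∷ p)  (false ∷ q) = s≤s (∣p∪q∣≤∣p∣+∣q∣ p q)
∣p∪q∣≤∣p∣+∣q∣ (false ∷ p) (true ∷ q)  = ≤-trans (s≤s (∣p∪q∣≤∣p∣+∣q∣ p q)) (≤-reflexive (sym (+-suc _ _)))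
∣p∪q∣≤∣p∣+∣q∣ (false ∷ p) (false ∷ q) = ∣p∪q∣≤∣p∣+∣q∣ p q

sum-tabulate-mono : ∀ {n} {f g : Fin n → ℕ} → (∀ i → f i ≤ g i) → sum (tabulate f) ≤ sum (tabulate g)
sum-tabulate-mono {zero}  f≤g = z≤n
sum-tabulate-mono {suc n} f≤g = +-mono-≤ (f≤g zero) (sum-tabulate-mono (λ i → f≤g (suc i)))

sum-tabulate-< : ∀ {n} {f g : Fin n → ℕ} → (∀ i → f i ≤ g i) → ∀ j → f j < g j →
                 sum (tabulate f) < sum (tabulate g)
sum-tabulate-< f≤g zero    fj<gj = +-mono-<-≤ fj<gj (sum-tabulate-mono (λ i → f≤g (suc i)))
sum-tabulate-< f≤g (suc j) fj<gj = +-mono-≤-< (f≤g zero) (sum-tabulate-< (λ i → f≤g (suc i)) j fj<gj)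

module _ {n : ℕ} where

  N : Graph n → Fin n → Subset n
  N H a = tabulate (adj H a)

  ∈N⁺ : ∀ H {a t} → Adj H a t → t ∈ N H a
  ∈N⁺ H {a} {t} e = lookup⇒[]= t (N H a) (trans (lookup∘tabulate (adj H a) t) e)

  ∈N⁻ : ∀ H {a t} → t ∈ N H a → Adj H a t
  ∈N⁻ H {a} {t} m = trans (sym (lookup∘tabulate (adj H a) t)) ([]=⇒lookup m)

  N⊆S⇒deg≤∣S∣ : ∀ {H a} (S : Subset n) → (∀ {t} → Adj H a t → t ∈ S) → deg H a ≤ ∣ S ∣
  N⊆S⇒deg≤∣S∣ {H} S N⊆S = p⊆q⇒∣p∣≤∣q∣ (λ m → N⊆S (∈N⁻ H m))

  deg-mono : ∀ H H′ {a} → (∀ {t} → Adj H a t → Adj H′ a t) → deg H a ≤ deg H′ a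
  deg-mono H H′ {a} H⊆H′ = N⊆S⇒deg≤∣S∣ {H} (N H′ a) (λ e → ∈N⁺ H′ (H⊆H′ e))

  deg-cong : ∀ H H′ {a} → (∀ {t} → Adj H a t → Adj H′ a t) → (∀ {t} → Adj H′ a t → Adj H a t) →
             deg H a ≡ deg H′ a
  deg-cong H H′ H⊆H′ H′⊆H = ≤-antisym (deg-mono H H′ H⊆H′) (deg-mono H′ H H′⊆H)

  deg-< : ∀ H H′ {a b} → (∀ {t} → Adj H a t → Adj H′ a t) → Adj H′ a b → ¬ Adj H a b →
          deg H a < deg H′ a
  deg-< H H′ H⊆H′ e ¬e =
    p⊂q⇒∣p∣<∣q∣ ((λ m → ∈N⁺ H′ (H⊆H′ (∈N⁻ H m))) , _ , ∈N⁺ H′ e , λ m → ¬e (∈N⁻ H m))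

  degreeSum : Graph n → ℕ
  degreeSum H = sum (tabulate (deg H))

  degreeSum-< : ∀ H H′ {a b} → (∀ {s t} → Adj H s t → Adj H′ s t) → Adj H′ a b → ¬ Adj H a b →
                degreeSum H < degreeSum H′
  degreeSum-< H H′ {a} H⊆H′ e ¬e =
    sum-tabulate-< (λ _ → deg-mono H H′ H⊆H′) a (deg-< H H′ H⊆H′ e ¬e)

module _ {n : ℕ} {E : Fin n → Fin n → Set} where

  mapWalk : ∀ {E′ : Fin n → Fin n → Set} → (∀ {a b} → E a b → E′ a b) →
            ∀ {u v} → Walk E u v → Walk E′ u v
  mapWalk f nil        = nil
  mapWalk f (cons e w) = cons (f e) (mapWalk f w)

  verts-mapWalk : ∀ {E′ : Fin n → Fin n → Set} (f : ∀ {a b} → E a b → E′ a b) →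
                  ∀ {u v} (w : Walk E u v) → verts (mapWalk f w) ≡ verts w
  verts-mapWalk f nil        = refl
  verts-mapWalk f (cons e w) = cong (_ ∷_) (verts-mapWalk f w)

  Unique-mapWalk : ∀ {E′ : Fin n → Fin n → Set} (f : ∀ {a b} → E a b → E′ a b) →
                   ∀ {u v} (w : Walk E u v) → Unique (verts w) → Unique (verts (mapWalk f w))
  Unique-mapWalk f w = subst Unique (sym (verts-mapWalk f w))

  EdgeOf-mapWalk⁻ : ∀ {E′ : Fin n → Fin n → Set} (f : ∀ {a b} → E a b → E′ a b) →
                    ∀ {u v} (w : Walk E u v) {a b} → EdgeOf (mapWalk f w) a b → EdgeOf w a b
  EdgeOf-mapWalk⁻ f (cons e w) (inj₁ ab) = inj₁ ab
  EdgeOf-mapWalk⁻ f (cons e w) (inj₂ ab) = inj₂ (EdgeOf-mapWalk⁻ f w ab)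

  infixr 5 _++ʷ_
  _++ʷ_ : ∀ {a b c} → Walk E a b → Walk E b c → Walk E a c
  nil       ++ʷ w₂ = w₂
  cons e w₁ ++ʷ w₂ = cons e (w₁ ++ʷ w₂)

  infixl 5 _∷ʳ_
  _∷ʳ_ : ∀ {a b c} → Walk E a b → E b c → Walk E a c
  w ∷ʳ e = w ++ʷ cons e nil

  reverse : (∀ {a b} → E a b → E b a) → ∀ {a b} → Walk E a b → Walk E b a
  reverse E-sym nil        = nil
  reverse E-sym (cons e w) = reverse E-sym w ∷ʳ E-sym e

  EdgeOf-++⁻ : ∀ {a b c} (w₁ : Walk E a b) (w₂ : Walk E b c) {s t} →
               EdgeOf (w₁ ++ʷ w₂) s t → EdgeOf w₁ s t ⊎ EdgeOf w₂ s t
  EdgeOf-++⁻ nil         w₂ st        = inj₂ st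
  EdgeOf-++⁻ (cons e w₁) w₂ (inj₁ st) = inj₁ (inj₁ st)
  EdgeOf-++⁻ (cons e w₁) w₂ (inj₂ st) with EdgeOf-++⁻ w₁ w₂ st
  ... | inj₁ st₁ = inj₁ (inj₂ st₁)
  ... | inj₂ st₂ = inj₂ st₂

  EdgeOf⇒E : ∀ {a b} (w : Walk E a b) {s t} → EdgeOf w s t → E s t ⊎ E t s
  EdgeOf⇒E (cons e w) (inj₁ (inj₁ (refl , refl))) = inj₁ e
  EdgeOf⇒E (cons e w) (inj₁ (inj₂ (refl , refl))) = inj₂ e
  EdgeOf⇒E (cons e w) (inj₂ st)                   = EdgeOf⇒E w st

  Walk-from-isolated : ∀ {u} → (∀ t → ¬ E u t) → ∀ {z} → Walk E u z → u ≡ z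
  Walk-from-isolated no-edge nil        = refl
  Walk-from-isolated no-edge (cons e _) = contradiction e (no-edge _)

  All-verts-closed : {P : Fin n → Set} → (∀ {s t} → E s t → P s → P t) →
                     ∀ {a b} (w : Walk E a b) → P a → All P (verts w)
  All-verts-closed cl nil        pa = pa ∷ []
  All-verts-closed cl (cons e w) pa = pa ∷ All-verts-closed cl w (cl e pa)

  closed⇒end : {P : Fin n → Set} → (∀ {s t} → E s t → P s → P t) →
               ∀ {a b} → Walk E a b → P a → P b
  closed⇒end cl nil        pa = pa
  closed⇒end cl (cons e w) pa = closed⇒end cl w (cl e pa)

  mapWalk-within : ∀ {E′ : Fin n → Fin n → Set} {P : Fin n → Set} →
                   (∀ {s t} → E s t → P s → P t) → (∀ {s t} → E s t → P s → P t → E′ s t) →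
                   ∀ {a b} → P a → Walk E a b → Walk E′ a b
  mapWalk-within cl f pa nil        = nil
  mapWalk-within cl f pa (cons e w) = cons (f e pa (cl e pa)) (mapWalk-within cl f (cl e pa) w)

  verts-++-cons : ∀ {a v u c} (w₁ : Walk E a v) (e : E v u) (w₂ : Walk E u c) →
                  verts (w₁ ++ʷ cons e w₂) ≡ verts w₁ ++ verts w₂
  verts-++-cons nil          e w₂ = refl
  verts-++-cons (cons e′ w₁) e w₂ = cong (_ ∷_) (verts-++-cons w₁ e w₂)

  Unique-++-cons : {A B : Fin n → Set} → (∀ {z} → A z → B z → ⊥) →
                   ∀ {a v u c} (w₁ : Walk E a v) (e : E v u) (w₂ : Walk E u c) →
                   All A (verts w₁) → All B (verts w₂) → Unique (verts w₁) → Unique (verts w₂) →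
                   Unique (verts (w₁ ++ʷ cons e w₂))
  Unique-++-cons A∩B=∅ w₁ e w₂ A₁ B₂ u₁ u₂ =
    subst Unique (sym (verts-++-cons w₁ e w₂))
      (Unique.++⁺ u₁ u₂ (λ (m₁ , m₂) → A∩B=∅ (All.lookup A₁ m₁) (All.lookup B₂ m₂)))

module Reachability {n : ℕ} (E : Fin n → Fin n → Set) (E? : ∀ a b → Dec (E a b)) where

  private
    Into : Subset n → Fin n → Fin n → Set
    Into A a b = E a b × b ∈ A

    from-last-visit : ∀ {A} t {a v} → Walk (Into A) a v →
                      Walk (Into (A - t)) a v ⊎ Walk (Into (A - t)) t v
    from-last-visit t nil = inj₁ nil
    from-last-visit t (cons {v = b} (e , b∈A) w) with from-last-visit t w
    ... | inj₂ w′ = inj₂ w′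
    ... | inj₁ w′ with b ≟ᶠ t
    ...   | yes refl = inj₂ w′
    ...   | no b≢t   = inj₁ (cons (e , x∈p∧x≢y⇒x∈p-y b∈A b≢t) w′)

    avoid-start : ∀ {A} t {v} → Walk (Into A) t v → Walk (Into (A - t)) t v
    avoid-start t w with from-last-visit t w
    ... | inj₁ w′ = w′
    ... | inj₂ w′ = w′

    -- After a first step to t, a walk into A can be cut at its last visit to t and then stays in
    -- A - t, so the recursion is on ∣ A ∣.
    reach-within? : ∀ A → Acc _<_ ∣ A ∣ → ∀ u v → Dec (Walk (Into A) u v)
    reach-within? A (acc rs) u v with u ≟ᶠ v
    ... | yes refl = yes nil
    ... | no u≢v with any? first-step?
      where
      first-step? : ∀ t → Dec (E u t × t ∈ A × Walk (Into (A - t)) t v)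
      first-step? t with E? u t ×-dec t ∈? A
      ... | no ¬et      = no λ (e , t∈A , _) → ¬et (e , t∈A)
      ... | yes (e , t∈A) with reach-within? (A - t) (rs (x∈p⇒∣p-x∣<∣p∣ t∈A)) t v
      ...   | yes w = yes (e , t∈A , w)
      ...   | no ¬w = no λ (_ , _ , w) → ¬w w
    ... | yes (t , e , t∈A , w) = yes (cons (e , t∈A) (mapWalk (λ (e′ , m) → e′ , p─q⊆p _ _ m) w))
    ... | no ¬step = no λ { nil → u≢v refl
                          ; (cons {v = t} (e , t∈A) w) → ¬step (t , e , t∈A , avoid-start t w) }

  reach? : ∀ u v → Dec (Walk E u v)
  reach? u v with reach-within? ⊤ (<-wellFounded _) u v
  ... | yes w = yes (mapWalk proj₁ w)
  ... | no ¬w = no λ w → ¬w (mapWalk (λ e → e , ∈⊤) w)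

∧≡true⁻ : ∀ {a b} → a ∧ b ≡ true → a ≡ true × b ≡ true
∧≡true⁻ {true} {true} refl = refl , refl

does≡true⇒ : ∀ {A : Set} (a? : Dec A) → does a? ≡ true → A
does≡true⇒ (yes a) _ = a

module _ {n : ℕ} where

  Adj? : ∀ (H : Graph n) a b → Dec (Adj H a b)
  Adj? H a b = adj H a b ≟ᵇ true

  Adj-sym : ∀ (H : Graph n) {a b} → Adj H a b → Adj H b a
  Adj-sym H {a} {b} e = trans (adj-sym H b a) e

  Adj-irrefl : ∀ (H : Graph n) {a} → ¬ Adj H a a
  Adj-irrefl H {a} e with trans (sym (irrefl H a)) e
  ... | ()

  reverseᴴ : ∀ (H : Graph n) {a b} → Walk (Adj H) a b → Walk (Adj H) b a
  reverseᴴ H = reverse (Adj-sym H)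

  keepEdges : (H : Graph n) (P : Fin n → Fin n → Set) → (∀ a b → Dec (P a b)) →
              (∀ {a b} → P a b → P b a) → Graph n
  keepEdges H P P? P-sym = record
    { adj    = λ a b → adj H a b ∧ does (P? a b)
    ; sym    = λ a b → cong₂ _∧_ (adj-sym H a b) (does-⇔ (mk⇔ P-sym P-sym) (P? a b) (P? b a))
    ; irrefl = λ a → cong (_∧ _) (irrefl H a)
    }

  module _ (H : Graph n) {P : Fin n → Fin n → Set} (P? : ∀ a b → Dec (P a b))
           (P-sym : ∀ {a b} → P a b → P b a) where

    Adj-keepEdges⁻ : ∀ {a b} → Adj (keepEdges H P P? P-sym) a b → Adj H a b × P a b
    Adj-keepEdges⁻ {a} {b} e with ∧≡true⁻ e
    ... | eH , eP = eH , does≡true⇒ (P? a b) eP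

    Adj-keepEdges⁺ : ∀ {a b} → Adj H a b → P a b → Adj (keepEdges H P P? P-sym) a b
    Adj-keepEdges⁺ {a} {b} eH p rewrite eH | dec-true (P? a b) p = refl

  module _ (H : Graph n) (V : Subset n) where

    private
      both? : ∀ a b → Dec (a ∈ V × b ∈ V)
      both? a b = a ∈? V ×-dec b ∈? V

      both-sym : ∀ {a b} → a ∈ V × b ∈ V → b ∈ V × a ∈ V
      both-sym (a∈V , b∈V) = b∈V , a∈V

    induced : Graph n
    induced = keepEdges H (λ a b → a ∈ V × b ∈ V) both? both-sym

    Adj-induced⁻ : ∀ {a b} → Adj induced a b → Adj H a b × a ∈ V × b ∈ V
    Adj-induced⁻ = Adj-keepEdges⁻ H both? both-sym

    Adj-induced⁺ : ∀ {a b} → Adj H a b → a ∈ V → b ∈ V → Adj induced a b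
    Adj-induced⁺ e a∈V b∈V = Adj-keepEdges⁺ H both? both-sym e (a∈V , b∈V)

  Ends : Fin n → Fin n → Fin n → Fin n → Set
  Ends p q a b = (a ≡ p × b ≡ q) ⊎ (a ≡ q × b ≡ p)

  Ends-sym : ∀ {p q a b} → Ends p q a b → Ends p q b a
  Ends-sym (inj₁ (a≡p , b≡q)) = inj₂ (b≡q , a≡p)
  Ends-sym (inj₂ (a≡q , b≡p)) = inj₁ (b≡p , a≡q)

  module _ (H : Graph n) (p q : Fin n) where

    private
      ¬ends? : ∀ a b → Dec (¬ Ends p q a b)
      ¬ends? a b = ¬? ((a ≟ᶠ p ×-dec b ≟ᶠ q) ⊎-dec (a ≟ᶠ q ×-dec b ≟ᶠ p))

      ¬ends-sym : ∀ {a b} → ¬ Ends p q a b → ¬ Ends p q b a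
      ¬ends-sym ¬ends ends = ¬ends (Ends-sym ends)

    removeEdge : Graph n
    removeEdge = keepEdges H (λ a b → ¬ Ends p q a b) ¬ends? ¬ends-sym

    Adj-removeEdge⁻ : ∀ {a b} → Adj removeEdge a b → Adj H a b
    Adj-removeEdge⁻ e = proj₁ (Adj-keepEdges⁻ H ¬ends? ¬ends-sym e)

    ¬Adj-removeEdge : ∀ {a b} → Ends p q a b → ¬ Adj removeEdge a b
    ¬Adj-removeEdge ends e = proj₂ (Adj-keepEdges⁻ H ¬ends? ¬ends-sym e) ends

    Adj-removeEdge⁺ : ∀ {a b} → Adj H a b → Adj removeEdge a b ⊎ Ends p q a b
    Adj-removeEdge⁺ {a} {b} e with ¬ends? a b
    ... | yes ¬ends = inj₁ (Adj-keepEdges⁺ H ¬ends? ¬ends-sym e ¬ends)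
    ... | no ¬¬ends = inj₂ (decidable-stable ((a ≟ᶠ p ×-dec b ≟ᶠ q) ⊎-dec (a ≟ᶠ q ×-dec b ≟ᶠ p)) ¬¬ends)

    deg-removeEdge : ∀ {a} → a ≢ p → a ≢ q → deg removeEdge a ≡ deg H a
    deg-removeEdge a≢p a≢q = deg-cong removeEdge H Adj-removeEdge⁻ kept
      where
      kept : ∀ {t} → Adj H _ t → Adj removeEdge _ t
      kept e with Adj-removeEdge⁺ e
      ... | inj₁ e′              = e′
      ... | inj₂ (inj₁ (a≡p , _)) = contradiction a≡p a≢p
      ... | inj₂ (inj₂ (a≡q , _)) = contradiction a≡q a≢q

    bypass : Walk (Adj removeEdge) p q → ∀ {a b} → Walk (Adj H) a b → Walk (Adj removeEdge) a b
    bypass detour nil = nil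
    bypass detour (cons e w) with Adj-removeEdge⁺ e
    ... | inj₁ e′                  = cons e′ (bypass detour w)
    ... | inj₂ (inj₁ (refl , refl)) = detour ++ʷ bypass detour w
    ... | inj₂ (inj₂ (refl , refl)) = reverseᴴ removeEdge detour ++ʷ bypass detour w

  component : Graph n → Fin n → Subset n
  component K a = tabulate (λ z → does (Reachability.reach? (Adj K) (Adj? K) a z))

  module _ (K : Graph n) (a : Fin n) where

    ∈component⁺ : ∀ {z} → Walk (Adj K) a z → z ∈ component K a
    ∈component⁺ {z} w = lookup⇒[]= z (component K a)
      (trans (lookup∘tabulate _ z) (dec-true (Reachability.reach? (Adj K) (Adj? K) a z) w))

    ∈component⁻ : ∀ {z} → z ∈ component K a → Walk (Adj K) a z
    ∈component⁻ {z} m = does≡true⇒ (Reachability.reach? (Adj K) (Adj? K) a z)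
      (trans (sym (lookup∘tabulate _ z)) ([]=⇒lookup m))

    component-closed : ∀ {s t} → Adj K s t → s ∈ component K a → t ∈ component K a
    component-closed e s∈C = ∈component⁺ (∈component⁻ s∈C ∷ʳ e)

    component-connected : ∀ H → (∀ {s t} → Adj K s t → Adj H s t) →
                          ConnectedSub (component K a) (induced H (component K a))
    component-connected H K⊆H s t s∈C t∈C =
      mapWalk-within {P = _∈ component K a} component-closed (λ e → Adj-induced⁺ H _ (K⊆H e)) s∈C
        (reverseᴴ K (∈component⁻ s∈C) ++ʷ ∈component⁻ t∈C)

liftMinusPath : ∀ {n} {H H′ : Graph n} {x y x′ y′} (P : Walk (Adj H) x y) (P′ : Walk (Adj H′) x′ y′) →
                (∀ {a b} → Adj H′ a b → Adj H a b) →
                (∀ {a b} → Adj H′ a b → EdgeOf P a b → EdgeOf P′ a b) →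
                ∀ {u v} → Walk (AdjMinusPath H′ P′) u v → Walk (AdjMinusPath H P) u v
liftMinusPath P P′ H′⊆H P∩H′⊆P′ = mapWalk (λ (e , ∉P′) → H′⊆H e , λ ∈P → ∉P′ (P∩H′⊆P′ e ∈P))

module _ {n : ℕ} where

  induced-⊆ : ∀ {G H : Graph n} {VH} V → IsSubgraph G VH H → IsSubgraph G V (induced H V)
  induced-⊆ {H = H} V H⊆G a b e with Adj-induced⁻ H V e
  ... | eH , a∈V , b∈V = proj₁ (H⊆G a b eH) , a∈V , b∈V

  -- A flagged path end is charged one unit of degree: in the bridge case it stands for the bridge
  -- edge, which the side graph lacks but the path through H uses.
  charge : Bool → Fin n → Fin n → ℕ
  charge false x z = 0
  charge true  x z with z ≟ᶠ x
  ... | yes _ = 1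
  ... | no  _ = 0

  charge-≢ : ∀ b {x z} → z ≢ x → charge b x z ≡ 0
  charge-≢ false z≢x = refl
  charge-≢ true {x} {z} z≢x with z ≟ᶠ x
  ... | yes z≡x = contradiction z≡x z≢x
  ... | no  _   = refl

  charge≤1 : ∀ b x z → charge b x z ≤ 1
  charge≤1 false x z = z≤n
  charge≤1 true  x z with z ≟ᶠ x
  ... | yes _ = ≤-refl
  ... | no  _ = z≤n

  record Low (H : Graph n) (x y : Fin n) (bx by : Bool) (z : Fin n) : Set where
    constructor low
    field
      charged-deg≤2 : deg H z + (charge bx x z + charge by y z) ≤ 2

  HasLowVertex : Graph n → Subset n → Fin n → Fin n → Bool → Bool → Set
  HasLowVertex H VH x y bx by = ∃ λ z → z ∈ VH × Low H x y bx by z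

  Low? : ∀ H x y bx by z → Dec (Low H x y bx by z)
  Low? H x y bx by z = map′ low Low.charged-deg≤2 (_ ≤? 2)

  Low-deg-mono : ∀ {H H′ x y bx by z} → deg H′ z ≤ deg H z → Low H x y bx by z → Low H′ x y bx by z
  Low-deg-mono H′≤H (low bound) = low (≤-trans (+-monoˡ-≤ _ H′≤H) bound)

  Low-unflagged⁺ : ∀ {H x y z} → deg H z ≤ 2 → Low H x y false false z
  Low-unflagged⁺ {H} {z = z} deg≤2 = low (subst (_≤ 2) (sym (+-identityʳ (deg H z))) deg≤2)

  Low-unflagged⁻ : ∀ {H x y z} → Low H x y false false z → deg H z ≤ 2
  Low-unflagged⁻ {H} {z = z} (low bound) = subst (_≤ 2) (+-identityʳ (deg H z)) bound

  Low-inner : ∀ {H x y} bx by {z} → z ≢ x → z ≢ y → deg H z ≤ 2 → Low H x y bx by z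
  Low-inner {H} bx by {z} z≢x z≢y deg≤2 = low (subst (_≤ 2) (sym no-charge) deg≤2)
    where
    no-charge : deg H z + (charge bx _ z + charge by _ z) ≡ deg H z
    no-charge = trans (cong (deg H z +_) (cong₂ _+_ (charge-≢ bx z≢x) (charge-≢ by z≢y))) (+-identityʳ _)

  only-neighbour⇒Low : ∀ {H x y} bx by → (∀ {t} → Adj H x t → t ≡ y) → Low H x y bx by x
  only-neighbour⇒Low {H} {x} {y} bx by only-y with x ≟ᶠ y
  ... | yes refl = low $ +-mono-≤ (≤-trans (N⊆S⇒deg≤∣S∣ {H = H} ∅ no-neighbour) (≤-reflexive (∣⊥∣≡0 n)))
                                 (+-mono-≤ (charge≤1 bx x x) (charge≤1 by x x))
    where
    no-neighbour : ∀ {t} → Adj H x t → t ∈ ∅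
    no-neighbour e = contradiction (subst (Adj H x) (only-y e) e) (Adj-irrefl H)
  ... | no x≢y   = low $ +-mono-≤ (≤-trans (N⊆S⇒deg≤∣S∣ {H = H} ⁅ y ⁆ neighbour-y) (≤-reflexive (∣⁅x⁆∣≡1 y)))
                                 (+-mono-≤ (charge≤1 bx x x) (≤-reflexive (charge-≢ by x≢y)))
    where
    neighbour-y : ∀ {t} → Adj H x t → t ∈ ⁅ y ⁆
    neighbour-y e = subst (_∈ ⁅ y ⁆) (sym (only-y e)) (x∈⁅x⁆ y)

  Low-swap : ∀ {H x y bx by z} → Low H x y bx by z → Low H y x by bx z
  Low-swap {H} {x} {y} {bx} {by} {z} (low bound) =
    low (subst (λ c → deg H z + c ≤ 2) (+-comm (charge bx x z) (charge by y z)) bound)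

  record Bridge (H : Graph n) (VH : Subset n) (p q : Fin n) : Set where
    field
      Vp Vq       : Subset n
      p∈Vp        : p ∈ Vp
      q∈Vq        : q ∈ Vq
      Adj-pq      : Adj H p q
      cover       : ∀ {z} → z ∈ VH → z ∈ Vp ⊎ z ∈ Vq
      disjoint    : ∀ {z} → z ∈ Vp → z ∈ Vq → ⊥
      leave-p     : ∀ {a b} → Adj H a b → a ∈ Vp → b ∈ Vp ⊎ (a ≡ p × b ≡ q)
      leave-q     : ∀ {a b} → Adj H a b → a ∈ Vq → b ∈ Vq ⊎ (a ≡ q × b ≡ p)
      connected-p : ConnectedSub Vp (induced H Vp)
      connected-q : ConnectedSub Vq (induced H Vq)

  Bridge-sym : ∀ {H VH p q} → Bridge H VH p q → Bridge H VH q p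
  Bridge-sym {H} b = record
    { Vp = Vq ; Vq = Vp ; p∈Vp = q∈Vq ; q∈Vq = p∈Vp ; Adj-pq = Adj-sym H Adj-pq
    ; cover = λ z∈VH → Data.Sum.swap (cover z∈VH) ; disjoint = λ z∈Vq z∈Vp → disjoint z∈Vp z∈Vq
    ; leave-p = leave-q ; leave-q = leave-p ; connected-p = connected-q ; connected-q = connected-p }
    where open Bridge b

  bridge : ∀ {H VH p q} → ConnectedSub VH H → p ∈ VH → Adj H p q →
           ¬ Walk (Adj (removeEdge H p q)) p q → Bridge H VH p q
  bridge {H} {VH} {p} {q} conn p∈VH pq ¬detour = record
    { Vp = component K p ; Vq = component K q
    ; p∈Vp = ∈component⁺ K p nil ; q∈Vq = ∈component⁺ K q nil ; Adj-pq = pq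
    ; cover = λ z∈VH → Data.Sum.map (∈component⁺ K p) (∈component⁺ K q)
                                    (side (conn p _ p∈VH z∈VH) (inj₁ nil))
    ; disjoint = λ z∈Vp z∈Vq → ¬detour (∈component⁻ K p z∈Vp ++ʷ reverseᴴ K (∈component⁻ K q z∈Vq))
    ; leave-p = leave-p ; leave-q = leave-q
    ; connected-p = component-connected K p H (Adj-removeEdge⁻ H p q)
    ; connected-q = component-connected K q H (Adj-removeEdge⁻ H p q)
    }
    where
    K : Graph n
    K = removeEdge H p q

    side : ∀ {a z} → Walk (Adj H) a z → Walk (Adj K) p a ⊎ Walk (Adj K) q a →
           Walk (Adj K) p z ⊎ Walk (Adj K) q z
    side nil        r = r
    side (cons e w) r with Adj-removeEdge⁺ H p q e | r
    ... | inj₁ e′                  | inj₁ r′ = side w (inj₁ (r′ ∷ʳ e′))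
    ... | inj₁ e′                  | inj₂ r′ = side w (inj₂ (r′ ∷ʳ e′))
    ... | inj₂ (inj₁ (refl , refl)) | _       = side w (inj₂ nil)
    ... | inj₂ (inj₂ (refl , refl)) | _       = side w (inj₁ nil)

    leave-p : ∀ {a b} → Adj H a b → a ∈ component K p → b ∈ component K p ⊎ (a ≡ p × b ≡ q)
    leave-p e a∈Vp with Adj-removeEdge⁺ H p q e
    ... | inj₁ e′                  = inj₁ (component-closed K p e′ a∈Vp)
    ... | inj₂ (inj₁ ends)          = inj₂ ends
    ... | inj₂ (inj₂ (refl , refl)) = contradiction (∈component⁻ K p a∈Vp) ¬detour

    leave-q : ∀ {a b} → Adj H a b → a ∈ component K q → b ∈ component K q ⊎ (a ≡ q × b ≡ p)
    leave-q e a∈Vq with Adj-removeEdge⁺ H p q e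
    ... | inj₁ e′                  = inj₁ (component-closed K q e′ a∈Vq)
    ... | inj₂ (inj₁ (refl , refl)) = contradiction (reverseᴴ K (∈component⁻ K q a∈Vq)) ¬detour
    ... | inj₂ (inj₂ ends)          = inj₂ ends

  module Side {H : Graph n} {VH : Subset n} {p q : Fin n} (b : Bridge H VH p q) where
    open Bridge b

    Hp : Graph n
    Hp = induced H Vp

    Hp⊆H : ∀ {s t} → Adj Hp s t → Adj H s t
    Hp⊆H e = proj₁ (Adj-induced⁻ H Vp e)

    Adj-Hp⇒∈Vp : ∀ {s t} → Adj Hp s t → s ∈ Vp × t ∈ Vp
    Adj-Hp⇒∈Vp e = proj₂ (Adj-induced⁻ H Vp e)

    q∉Vp : q ∉ Vp
    q∉Vp q∈Vp = disjoint q∈Vp q∈Vq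

    EdgeOf-Hp⇒∈Vp : ∀ {a b} (Pp : Walk (Adj Hp) a b) {s t} → EdgeOf (mapWalk Hp⊆H Pp) s t → s ∈ Vp × t ∈ Vp
    EdgeOf-Hp⇒∈Vp Pp st∈P with EdgeOf⇒E Pp (EdgeOf-mapWalk⁻ Hp⊆H Pp st∈P)
    ... | inj₁ st = Adj-Hp⇒∈Vp st
    ... | inj₂ ts = Data.Product.swap (Adj-Hp⇒∈Vp ts)

    verts-Hp⊆Vp : ∀ {a b} (Pp : Walk (Adj Hp) a b) → a ∈ Vp → All (_∈ Vp) (verts (mapWalk Hp⊆H Pp))
    verts-Hp⊆Vp Pp a∈Vp = subst (All (_∈ Vp)) (sym (verts-mapWalk Hp⊆H Pp))
                            (All-verts-closed (λ e _ → proj₂ (Adj-Hp⇒∈Vp e)) Pp a∈Vp)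

    end∈Vp : ∀ {x y} {Pp : Walk (Adj Hp) x y} {s t} → Walk (AdjMinusPath Hp Pp) s t → s ∈ Vp → t ∈ Vp
    end∈Vp = closed⇒end (λ (e , _) _ → proj₂ (Adj-Hp⇒∈Vp e))

    avoiding : ∀ {x y} (P : Walk (Adj H) x y) → (∀ {a b} → EdgeOf P a b → a ∉ Vp) →
               ∀ {s t} → Walk (Adj Hp) s t → Walk (AdjMinusPath H P) s t
    avoiding P P∩Vp=∅ = mapWalk (λ e → Hp⊆H e , λ ∈P → P∩Vp=∅ ∈P (proj₁ (Adj-Hp⇒∈Vp e)))

    degreeSum-Hp< : degreeSum Hp < degreeSum H
    degreeSum-Hp< = degreeSum-< Hp H Hp⊆H Adj-pq (λ e → q∉Vp (proj₂ (Adj-Hp⇒∈Vp e)))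

    deg-Hp : ∀ {a} → a ∈ Vp → a ≢ p → deg Hp a ≡ deg H a
    deg-Hp {a} a∈Vp a≢p = deg-cong Hp H Hp⊆H (λ e → Adj-induced⁺ H Vp e a∈Vp (stays e))
      where
      stays : ∀ {t} → Adj H a t → t ∈ Vp
      stays e with leave-p e a∈Vp
      ... | inj₁ t∈Vp      = t∈Vp
      ... | inj₂ (a≡p , _) = contradiction a≡p a≢p

    deg-H≤ : ∀ {a} → a ∈ Vp → deg H a ≤ deg Hp a + charge true p a
    deg-H≤ {a} a∈Vp with a ≟ᶠ p
    ... | no a≢p   = ≤-trans (≤-reflexive (sym (deg-Hp a∈Vp a≢p))) (m≤m+n _ 0)
    ... | yes refl = begin
      deg H p                ≤⟨ N⊆S⇒deg≤∣S∣ {H = H} (N Hp p ∪ ⁅ q ⁆) neighbour ⟩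
      ∣ N Hp p ∪ ⁅ q ⁆ ∣     ≤⟨ ∣p∪q∣≤∣p∣+∣q∣ (N Hp p) ⁅ q ⁆ ⟩
      deg Hp p + ∣ ⁅ q ⁆ ∣   ≡⟨ cong (deg Hp p +_) (∣⁅x⁆∣≡1 q) ⟩
      deg Hp p + 1           ∎
      where
      open ≤-Reasoning
      neighbour : ∀ {t} → Adj H p t → t ∈ N Hp p ∪ ⁅ q ⁆
      neighbour e with leave-p e p∈Vp
      ... | inj₁ t∈Vp       = x∈p∪q⁺ (inj₁ (∈N⁺ Hp (Adj-induced⁺ H Vp e p∈Vp t∈Vp)))
      ... | inj₂ (_ , refl) = x∈p∪q⁺ (inj₂ (x∈⁅x⁆ q))

    Low-from-Hp : ∀ {x y bx by w} → w ∈ Vp → y ∉ Vp → Low Hp x p bx true w → Low H x y bx by w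
    Low-from-Hp {x} {y} {bx} {by} {w} w∈Vp y∉Vp (low bound) = low $ begin
      deg H w + (charge bx x w + charge by y w)
        ≡⟨ cong (λ c → deg H w + (charge bx x w + c)) (charge-≢ by λ { refl → y∉Vp w∈Vp }) ⟩
      deg H w + (charge bx x w + 0)
        ≤⟨ +-monoˡ-≤ _ (deg-H≤ w∈Vp) ⟩
      deg Hp w + charge true p w + (charge bx x w + 0)
        ≡⟨ rearrange (deg Hp w) (charge true p w) (charge bx x w) ⟩
      deg Hp w + (charge bx x w + charge true p w)
        ≤⟨ bound ⟩
      2 ∎
      where
      open ≤-Reasoning
      rearrange : ∀ d c c′ → d + c + (c′ + 0) ≡ d + (c′ + c)
      rearrange = solve-∀

module _ {n : ℕ} (G : Graph n) (cubic : Cubic G) where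

  missing-edge⇒deg<3 : ∀ {VH H a b} → IsSubgraph G VH H → Adj G a b → ¬ Adj H a b → deg H a < 3
  missing-edge⇒deg<3 {H = H} {a} H⊆G e ¬e =
    subst (deg H a <_) (cubic a) (deg-< H G (λ e′ → proj₁ (H⊆G _ _ e′)) e ¬e)

  deg≥3⇒Adj : ∀ {VH H a b} → IsSubgraph G VH H → 3 ≤ deg H a → Adj G a b → Adj H a b
  deg≥3⇒Adj {H = H} {a} {b} H⊆G 3≤deg e with Adj? H a b
  ... | yes e′ = e′
  ... | no ¬e  = contradiction 3≤deg (<⇒≱ (missing-edge⇒deg<3 {H = H} H⊆G e ¬e))

  saturated-closed : ∀ {VH H} X → IsSubgraph G VH H → (∀ {a} → a ∈ VH → a ∉ X → 3 ≤ deg H a) →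
                     ∀ {z o} → Walk (AdjAvoid G X) z o → z ∈ VH → o ∈ VH
  saturated-closed {H = H} X H⊆G saturated = closed⇒end (λ (e , s∉X , _) s∈VH →
    proj₂ (proj₂ (H⊆G _ _ (deg≥3⇒Adj {H = H} H⊆G (saturated s∈VH s∉X) e))))

module _ {n : ℕ} (G : Graph n) (three-connected : ThreeConnected G) (cubic : Cubic G) where

  low-vertex : ∀ {VH H x y} bx by → IsSubgraph G VH H → x ∈ VH → y ∈ VH → ∀ {o} → o ∉ VH →
               HasLowVertex H VH x y bx by
  low-vertex {VH} {H} {x} {y} bx by H⊆G x∈VH y∈VH {o} o∉VH =
    decidable-stable (any? λ z → z ∈? VH ×-dec Low? H x y bx by z) ¬¬low
    where
    X : Subset n
    X = ⁅ x ⁆ ∪ ⁅ y ⁆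

    ∣X∣≤2 : ∣ X ∣ ≤ 2
    ∣X∣≤2 = ≤-trans (∣p∪q∣≤∣p∣+∣q∣ ⁅ x ⁆ ⁅ y ⁆) (+-mono-≤ (≤-reflexive (∣⁅x⁆∣≡1 x)) (≤-reflexive (∣⁅x⁆∣≡1 y)))

    ∉X : ∀ {a} → a ≢ x → a ≢ y → a ∉ X
    ∉X a≢x a≢y a∈X with x∈p∪q⁻ ⁅ x ⁆ ⁅ y ⁆ a∈X
    ... | inj₁ a∈⁅x⁆ = a≢x (x∈⁅y⁆⇒x≡y x a∈⁅x⁆)
    ... | inj₂ a∈⁅y⁆ = a≢y (x∈⁅y⁆⇒x≡y y a∈⁅y⁆)

    ∉X⁻ : ∀ {a} → a ∉ X → a ≢ x × a ≢ y
    ∉X⁻ a∉X = (λ { refl → a∉X (x∈p∪q⁺ (inj₁ (x∈⁅x⁆ x))) }) , (λ { refl → a∉X (x∈p∪q⁺ (inj₂ (x∈⁅x⁆ y))) })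

    ¬¬low : ¬ ¬ HasLowVertex H VH x y bx by
    ¬¬low ¬low with any? (λ z → z ∈? VH ×-dec ¬? (z ≟ᶠ x) ×-dec ¬? (z ≟ᶠ y))
    ... | yes (z , z∈VH , z≢x , z≢y) =
      o∉VH (saturated-closed G cubic {VH} {H} X H⊆G saturated
              (proj₂ three-connected X ∣X∣≤2 z o (∉X z≢x z≢y)
                 (∉X (λ { refl → o∉VH x∈VH }) (λ { refl → o∉VH y∈VH })))
              z∈VH)
      where
      saturated : ∀ {a} → a ∈ VH → a ∉ X → 3 ≤ deg H a
      saturated a∈VH a∉X = ≰⇒> λ deg≤2 →
        ¬low (_ , a∈VH , Low-inner {H = H} bx by (proj₁ (∉X⁻ a∉X)) (proj₂ (∉X⁻ a∉X)) deg≤2)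
    ... | no ¬inner = ¬low (x , x∈VH , only-neighbour⇒Low {H = H} bx by only-y)
      where
      only-y : ∀ {t} → Adj H x t → t ≡ y
      only-y {t} e = decidable-stable (t ≟ᶠ y) λ t≢y →
        ¬inner (t , proj₂ (proj₂ (H⊆G x t e)) , (λ { refl → Adj-irrefl H e }) , t≢y)

  ReachesLow : (H : Graph n) {x y : Fin n} → Walk (Adj H) x y → Bool → Bool → Fin n → Set
  ReachesLow H {x} {y} P bx by u = ∃ λ w → Reach (AdjMinusPath H P) u w × Low H x y bx by w

  Solution : Graph n → Subset n → Fin n → Fin n → Bool → Bool → Set
  Solution H VH x y bx by =
    Σ (Walk (Adj H) x y) λ P → IsPath {H = H} P × (∀ u → u ∈ VH → ReachesLow H P bx by u)

  SolvableBelow : Graph n → Set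
  SolvableBelow H = ∀ {H′ V′ x y} bx by → IsSubgraph G V′ H′ → ConnectedSub V′ H′ →
                    degreeSum H′ < degreeSum H → x ∈ V′ → y ∈ V′ →
                    HasLowVertex H′ V′ x y bx by → Solution H′ V′ x y bx by

  isolated : ∀ {H VH u x y} bx by → ConnectedSub VH H → u ∈ VH → (∀ t → ¬ Adj H u t) →
             x ∈ VH → y ∈ VH → Low H x y bx by u → Solution H VH x y bx by
  isolated {H} {VH} {u} bx by conn u∈VH no-edge x∈VH y∈VH low-u
    with Walk-from-isolated no-edge (conn u _ u∈VH x∈VH) | Walk-from-isolated no-edge (conn u _ u∈VH y∈VH)
  ... | refl | refl = nil , [] ∷ [] , λ z z∈VH →
    u , subst (Reach _ z) (sym (Walk-from-isolated no-edge (conn u z u∈VH z∈VH))) nil , low-u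

  non-bridge : ∀ {H VH u v x y} bx by → IsSubgraph G VH H → ConnectedSub VH H → SolvableBelow H →
               Adj H u v → Walk (Adj (removeEdge H u v)) u v → u ∈ VH → x ∈ VH → y ∈ VH →
               Low H x y bx by u → Solution H VH x y bx by
  non-bridge {H} {VH} {u} {v} {x} {y} bx by H⊆G conn smaller uv detour u∈VH x∈VH y∈VH low-u =
    P , Unique-mapWalk K⊆H PK (proj₁ (proj₂ RK)) , reach-low
    where
    K : Graph n
    K = removeEdge H u v

    K⊆H : ∀ {a b} → Adj K a b → Adj H a b
    K⊆H = Adj-removeEdge⁻ H u v

    RK : Solution K VH x y bx by
    RK = smaller bx by (λ a b e → H⊆G a b (K⊆H e))
           (λ a b a∈VH b∈VH → bypass H u v detour (conn a b a∈VH b∈VH))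
           (degreeSum-< K H K⊆H uv (¬Adj-removeEdge H u v (inj₁ (refl , refl))))
           x∈VH y∈VH (u , u∈VH , Low-deg-mono {H = H} {K} (deg-mono K H K⊆H) low-u)

    PK = proj₁ RK

    P : Walk (Adj H) x y
    P = mapWalk K⊆H PK

    lift : ∀ {a b} → Walk (AdjMinusPath K PK) a b → Walk (AdjMinusPath H P) a b
    lift = liftMinusPath {H = H} {K} P PK K⊆H (λ _ → EdgeOf-mapWalk⁻ K⊆H PK)

    vu∉P : ¬ EdgeOf P v u
    vu∉P vu∈P with EdgeOf⇒E PK (EdgeOf-mapWalk⁻ K⊆H PK vu∈P)
    ... | inj₁ vu = ¬Adj-removeEdge H u v (inj₂ (refl , refl)) vu
    ... | inj₂ uv = ¬Adj-removeEdge H u v (inj₁ (refl , refl)) uv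

    reach-low : ∀ z → z ∈ VH → ReachesLow H P bx by z
    reach-low z z∈VH with proj₂ (proj₂ RK) z z∈VH
    ... | w , r , low-w = redirect (w ≟ᶠ u) (w ≟ᶠ v) (lift r) low-w
      where
      redirect : ∀ {w} → Dec (w ≡ u) → Dec (w ≡ v) → Walk (AdjMinusPath H P) z w → Low K x y bx by w →
                 ReachesLow H P bx by z
      redirect (yes refl) _          r _     = u , r , low-u
      redirect (no _)     (yes refl) r _     = u , r ∷ʳ (Adj-sym H uv , vu∉P) , low-u
      redirect (no w≢u)   (no w≢v)   r low-w =
        _ , r , Low-deg-mono {H = K} {H} (≤-reflexive (sym (deg-removeEdge H u v w≢u w≢v))) low-w

  solve-side : ∀ {H VH p q} → IsSubgraph G VH H → SolvableBelow H → (b : Bridge H VH p q) →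
               ∀ {x y} bx by → x ∈ Bridge.Vp b → y ∈ Bridge.Vp b →
               Solution (Side.Hp b) (Bridge.Vp b) x y bx by
  solve-side {H} H⊆G smaller b bx by x∈Vp y∈Vp =
    smaller bx by Hp⊆G connected-p degreeSum-Hp< x∈Vp y∈Vp
      (low-vertex {H = Hp} bx by Hp⊆G x∈Vp y∈Vp q∉Vp)
    where
    open Bridge b
    open Side b

    Hp⊆G : IsSubgraph G Vp Hp
    Hp⊆G = induced-⊆ {G = G} {H = H} Vp H⊆G

  same-side : ∀ {H VH p q x y} bx by → IsSubgraph G VH H → SolvableBelow H → (b : Bridge H VH p q) →
              x ∈ Bridge.Vp b → y ∈ Bridge.Vp b → Low H x y bx by p ⊎ Low H x y bx by q →
              Solution H VH x y bx by
  same-side {H} {VH} {p} {q} {x} {y} bx by H⊆G smaller b x∈Vp y∈Vp low-end =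
    P , Unique-mapWalk Hp⊆H Pp (proj₁ (proj₂ Rp)) , reach-low
    where
    open Bridge b
    open Side b

    Rp : Solution Hp Vp x y bx by
    Rp = solve-side H⊆G smaller b bx by x∈Vp y∈Vp

    Pp = proj₁ Rp

    P : Walk (Adj H) x y
    P = mapWalk Hp⊆H Pp

    to-low-end : ∀ {z} → Low H x y bx by p ⊎ Low H x y bx by q →
                 Reach (AdjMinusPath H P) z p ⊎ Reach (AdjMinusPath H P) z q → ReachesLow H P bx by z
    to-low-end (inj₁ low-p) (inj₁ r-p) = p , r-p , low-p
    to-low-end (inj₂ low-q) (inj₂ r-q) = q , r-q , low-q
    to-low-end (inj₂ low-q) (inj₁ r-p) =
      q , r-p ∷ʳ (Adj-pq , λ pq∈P → q∉Vp (proj₂ (EdgeOf-Hp⇒∈Vp Pp pq∈P))) , low-q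
    to-low-end (inj₁ low-p) (inj₂ r-q) =
      p , r-q ∷ʳ (Adj-sym H Adj-pq , λ qp∈P → q∉Vp (proj₁ (EdgeOf-Hp⇒∈Vp Pp qp∈P))) , low-p

    from-Vp : ∀ {z w} → Dec (w ≡ p) → w ∈ Vp → Reach (AdjMinusPath H P) z w → Low Hp x y bx by w →
              ReachesLow H P bx by z
    from-Vp (yes refl) _    r _     = to-low-end low-end (inj₁ r)
    from-Vp (no w≢p)   w∈Vp r low-w =
      _ , r , Low-deg-mono {H = Hp} {H} (≤-reflexive (sym (deg-Hp w∈Vp w≢p))) low-w

    reach-low : ∀ z → z ∈ VH → ReachesLow H P bx by z
    reach-low z z∈VH with cover z∈VH
    ... | inj₂ z∈Vq =
      to-low-end low-end (inj₂ (Side.avoiding (Bridge-sym b) P P∩Vq=∅ (connected-q z q z∈Vq q∈Vq)))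
      where
      P∩Vq=∅ : ∀ {a b} → EdgeOf P a b → a ∉ Vq
      P∩Vq=∅ ab∈P = disjoint (proj₁ (EdgeOf-Hp⇒∈Vp Pp ab∈P))
    ... | inj₁ z∈Vp with proj₂ (proj₂ Rp) z z∈Vp
    ...   | w , r , low-w = from-Vp (w ≟ᶠ p) (end∈Vp r z∈Vp)
                              (liftMinusPath {H = H} {Hp} P Pp Hp⊆H (λ _ → EdgeOf-mapWalk⁻ Hp⊆H Pp) r) low-w

  across : ∀ {H VH p q x y} bx by → IsSubgraph G VH H → SolvableBelow H → (b : Bridge H VH p q) →
           x ∈ Bridge.Vp b → y ∈ Bridge.Vq b → Solution H VH x y bx by
  across {H} {VH} {p} {q} {x} {y} bx by H⊆G smaller b x∈Vp y∈Vq = P , P-path , reach-low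
    where
    open Bridge b
    module A = Side b
    module B = Side (Bridge-sym b)

    RA : Solution A.Hp Vp x p bx true
    RA = solve-side H⊆G smaller b bx true x∈Vp p∈Vp

    RB : Solution B.Hp Vq q y true by
    RB = solve-side H⊆G smaller (Bridge-sym b) true by q∈Vq y∈Vq

    PA = proj₁ RA
    PB = proj₁ RB

    P : Walk (Adj H) x y
    P = mapWalk A.Hp⊆H PA ++ʷ cons Adj-pq (mapWalk B.Hp⊆H PB)

    P-path : IsPath {H = H} P
    P-path = Unique-++-cons disjoint (mapWalk A.Hp⊆H PA) Adj-pq (mapWalk B.Hp⊆H PB)
               (A.verts-Hp⊆Vp PA x∈Vp) (B.verts-Hp⊆Vp PB q∈Vq)
               (Unique-mapWalk A.Hp⊆H PA (proj₁ (proj₂ RA))) (Unique-mapWalk B.Hp⊆H PB (proj₁ (proj₂ RB)))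

    P∩HA⊆PA : ∀ {a b} → Adj A.Hp a b → EdgeOf P a b → EdgeOf PA a b
    P∩HA⊆PA e ab∈P with A.Adj-Hp⇒∈Vp e | EdgeOf-++⁻ (mapWalk A.Hp⊆H PA) (cons Adj-pq (mapWalk B.Hp⊆H PB)) ab∈P
    ... | _         , _    | inj₁ ab∈PA                    = EdgeOf-mapWalk⁻ A.Hp⊆H PA ab∈PA
    ... | _         , b∈Vp | inj₂ (inj₁ (inj₁ (_ , refl))) = contradiction b∈Vp A.q∉Vp
    ... | a∈Vp      , _    | inj₂ (inj₁ (inj₂ (refl , _))) = contradiction a∈Vp A.q∉Vp
    ... | a∈Vp      , _    | inj₂ (inj₂ ab∈PB)             =
      contradiction (proj₁ (B.EdgeOf-Hp⇒∈Vp PB ab∈PB)) (disjoint a∈Vp)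

    P∩HB⊆PB : ∀ {a b} → Adj B.Hp a b → EdgeOf P a b → EdgeOf PB a b
    P∩HB⊆PB e ab∈P with B.Adj-Hp⇒∈Vp e | EdgeOf-++⁻ (mapWalk A.Hp⊆H PA) (cons Adj-pq (mapWalk B.Hp⊆H PB)) ab∈P
    ... | a∈Vq      , _    | inj₁ ab∈PA                    =
      contradiction a∈Vq (disjoint (proj₁ (A.EdgeOf-Hp⇒∈Vp PA ab∈PA)))
    ... | a∈Vq      , _    | inj₂ (inj₁ (inj₁ (refl , _))) = contradiction a∈Vq B.q∉Vp
    ... | _         , b∈Vq | inj₂ (inj₁ (inj₂ (_ , refl))) = contradiction b∈Vq B.q∉Vp
    ... | _         , _    | inj₂ (inj₂ ab∈PB)             = EdgeOf-mapWalk⁻ B.Hp⊆H PB ab∈PB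

    reach-low : ∀ z → z ∈ VH → ReachesLow H P bx by z
    reach-low z z∈VH with cover z∈VH
    ... | inj₁ z∈Vp with proj₂ (proj₂ RA) z z∈Vp
    ...   | w , r , low-w = w , liftMinusPath {H = H} {A.Hp} P PA A.Hp⊆H P∩HA⊆PA r
                              , A.Low-from-Hp (A.end∈Vp r z∈Vp) (λ y∈Vp → disjoint y∈Vp y∈Vq) low-w
    reach-low z z∈VH | inj₂ z∈Vq with proj₂ (proj₂ RB) z z∈Vq
    ...   | w , r , low-w = w , liftMinusPath {H = H} {B.Hp} P PB B.Hp⊆H P∩HB⊆PB r
                              , Low-swap (B.Low-from-Hp (B.end∈Vp r z∈Vq) (disjoint x∈Vp) (Low-swap low-w))

  via-bridge : ∀ {H VH p q x y} bx by → IsSubgraph G VH H → SolvableBelow H → Bridge H VH p q →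
               x ∈ VH → y ∈ VH → Low H x y bx by p → Solution H VH x y bx by
  via-bridge bx by H⊆G smaller b x∈VH y∈VH low-p with Bridge.cover b x∈VH | Bridge.cover b y∈VH
  ... | inj₁ x∈Vp | inj₁ y∈Vp = same-side bx by H⊆G smaller b x∈Vp y∈Vp (inj₁ low-p)
  ... | inj₂ x∈Vq | inj₂ y∈Vq = same-side bx by H⊆G smaller (Bridge-sym b) x∈Vq y∈Vq (inj₂ low-p)
  ... | inj₁ x∈Vp | inj₂ y∈Vq = across bx by H⊆G smaller b x∈Vp y∈Vq
  ... | inj₂ x∈Vq | inj₁ y∈Vp = across bx by H⊆G smaller (Bridge-sym b) x∈Vq y∈Vp

  step : ∀ {H VH x y} bx by → IsSubgraph G VH H → ConnectedSub VH H → SolvableBelow H →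
         x ∈ VH → y ∈ VH → HasLowVertex H VH x y bx by → Solution H VH x y bx by
  step {H} bx by H⊆G conn smaller x∈VH y∈VH (u , u∈VH , low-u) with any? (Adj? H u)
  ... | no no-edge = isolated bx by conn u∈VH (λ t e → no-edge (t , e)) x∈VH y∈VH low-u
  ... | yes (v , uv) with Reachability.reach? (Adj (removeEdge H u v)) (Adj? (removeEdge H u v)) u v
  ...   | yes detour = non-bridge bx by H⊆G conn smaller uv detour u∈VH x∈VH y∈VH low-u
  ...   | no ¬detour = via-bridge bx by H⊆G smaller (bridge conn u∈VH uv ¬detour) x∈VH y∈VH low-u

  solve : ∀ {H VH x y} bx by → IsSubgraph G VH H → ConnectedSub VH H → Acc _<_ (degreeSum H) →
          x ∈ VH → y ∈ VH → HasLowVertex H VH x y bx by → Solution H VH x y bx by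
  solve bx by H⊆G conn (acc smaller) =
    step bx by H⊆G conn λ bx′ by′ H′⊆G conn′ lt → solve bx′ by′ H′⊆G conn′ (smaller lt)

  initial-low-vertex : ∀ {VH H x y} → IsSubgraph G VH H → Proper G VH H → x ∈ VH → y ∈ VH →
                       HasLowVertex H VH x y false false
  initial-low-vertex H⊆G (inj₁ (o , o∉VH)) x∈VH y∈VH = low-vertex false false H⊆G x∈VH y∈VH o∉VH
  initial-low-vertex {VH} {H} H⊆G (inj₂ (a , b , ab∈G , ab∉H)) x∈VH y∈VH with a ∈? VH
  ... | no a∉VH  = low-vertex false false H⊆G x∈VH y∈VH a∉VH
  ... | yes a∈VH =
    a , a∈VH , Low-unflagged⁺ {H = H} (≤-pred (missing-edge⇒deg<3 G cubic {H = H} H⊆G ab∈G ab∉H))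

lemma7p1 : ∀ {n} (G : Graph n) → ThreeConnected G → Cubic G →
           (VH : Subset n) (H : Graph n) → IsSubgraph G VH H →
           ConnectedSub VH H → Proper G VH H →
           (x y : Fin n) → x ∈ VH → y ∈ VH →
           Σ (Walk (Adj H) x y) λ P → IsPath {H = H} P ×
             (∀ u → u ∈ VH →
                ∃ λ v → Reach (AdjMinusPath H P) u v × deg H v ≤ 2)
lemma7p1 G three-connected cubic VH H H⊆G conn proper x y x∈VH y∈VH
  with solve G three-connected cubic false false H⊆G conn (<-wellFounded _) x∈VH y∈VH
         (initial-low-vertex G three-connected cubic H⊆G proper x∈VH y∈VH)
... | P , P-path , reach-low = P , P-path , λ u u∈VH →
  let w , r , low-w = reach-low u u∈VH in w , r , Low-unflagged⁻ {H = H} low-w
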